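{- Let $\mathcal{Q}:(A\wedge B)$ be an SSAT formula, where $A$ and $B$ are in conjunctive normal form and $A\wedge B$ contains only non-tautological clauses. Then there is a pair $(\emptyset^p, \mathcal{I})$ derivable from $\mathcal{Q}:(A\wedge B)$ by interpolating S-resolution, and $\mathcal{I}$ is a generalized Craig interpolant for $(A,B)$.
   Context: An SSAT formula is $\mathcal{Q} : \varphi$ where $\mathcal{Q} = Q_1x_1\ldots Q_nx_n$ is a prefix of quantified propositional variables, each $Q_i$ being either $\exists$ or a randomized quantifier $\mathsf{R}^{p_i}$ with rational $0<p_i<1$, and $\varphi$ is a propositional formula with $\mathrm{Var}(\varphi)\subseteq\{x_1,\dots,x_n\}$. Its maximum probability of satisfaction is defined recursively: $Pr(\varepsilon:\varphi)$ is $0$ if $\varphi$ is equivalent to false and $1$ if equivalent to true; $Pr(\exists x\,\mathcal{Q}':\varphi) = \max(Pr(\mathcal{Q}':\varphi[\mathrm{true}/x]),Pr(\mathcal{Q}':\varphi[\mathrm{false}/x]))$; $Pr(\mathsf{R}^p x\,\mathcal{Q}':\varphi) = p\,Pr(\mathcal{Q}':\varphi[\mathrm{true}/x]) + (1-p)\,Pr(\mathcal{Q}':\varphi[\mathrm{false}/x])$. Sets: $V_A := \mathrm{Var}(A)\setminus\mathrm{Var}(B)=\{a_1,\dots,a_\alpha\}$, $V_B := \mathrm{Var}(B)\setminus\mathrm{Var}(A)=\{b_1,\dots,b_\beta\}$, $V_{A,B}:=\mathrm{Var}(A)\cap\mathrm{Var}(B)$. With $A^{\exists}:=\exists a_1,\dots,a_\alpha:A$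 and $\overline{B}^{\forall}:=\neg\exists b_1,\dots,b_\beta:B$, a propositional formula $\mathcal{I}$ is a generalized Craig interpolant for $(A,B)$ iff $\mathrm{Var}(\mathcal{I})\subseteq V_{A,B}$, $(A^{\exists}\wedge\overline{B}^{\forall})\Rightarrow\mathcal{I}$ is valid and $\mathcal{I}\Rightarrow(A^{\exists}\vee\overline{B}^{\forall})$ is valid. A clause is a disjunction (identified with a set) of literals without repetitions; tautological means valid. $\mathcal{Q}(\psi)$ is the shortest prefix $Q_1x_1\ldots Q_ix_i$ of $\mathcal{Q}$ containing all variables of $\psi$. For a non-tautological clause $c$, $\mathrm{ff}_c$ is the unique assignment on $\mathrm{Var}(c)$ falsifying $c$. S-resolution (for $\varphi = A\wedge B$) derives annotated clauses $c^p$: (R.1) every clause $c$ of $\varphi$ gives $c^0$; (R.2) if $c$ is a non-tautological clause over variables of $\varphi$, $\mathcal{Q}(c)=Q_1x_1\ldots Q_ix_i$, and for every $\tau:\{x_1,\dots,x_i\}\to\{\mathrm{true},\mathrm{false}\}$ agreeing with $\mathrm{ff}_c$ on $\mathrm{Var}(c)$ the formula $\varphi[\tau(x_1)/x_1]\ldots[\tau(x_i)/x_i]$ is valid, derive $c^1$; (R.3) from $(c_1\vee\neg x)^{p_1}$, $(c_2\vee x)^{p_2}$, where $Qx$ is in $\mathcal{Q}$ but not in $\mathcal{Q}(c_1\vee c_2)$ and $c_1\vee c_2$ is non-tautological, derive $(c_1\vee c_2)^p$ with $p=\max(p_1,p_2)$ if $Q=\exists$, $p=p_xp_1+(1-p_x)p_2$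 if $Q=\mathsf{R}^{p_x}$. Interpolating S-resolution derives pairs $(c^p, I)$ with $I$ a propositional formula: (R'.1) for a clause $c$ of $A$ derive $(c^0,\mathrm{false})$, for a clause $c$ of $B$ derive $(c^0,\mathrm{true})$; (R'.2) whenever $c^p$ is derivable by (R.2), derive $(c^p, I)$ for any propositional formula $I$ over $V_{A,B}$; (R'.3) from $((c_1\vee\neg x)^{p_1}, I_1)$ and $((c_2\vee x)^{p_2}, I_2)$ such that (R.3) yields $(c_1\vee c_2)^p$ from the two clauses, derive $((c_1\vee c_2)^p, I)$ where $I = I_1\vee I_2$ if $x\in V_A$, $I = I_1\wedge I_2$ if $x\in V_B$, and $I=(\neg x\vee I_1)\wedge(x\vee I_2)$ if $x\in V_{A,B}$. -}

module Defs where

open import Data.Bool using (Bool; true; false; _∧_; _∨_; not; if_then_else_)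
open import Data.Nat using (ℕ; _≡ᵇ_)
open import Data.List using (List; []; _∷_; _++_; map; concatMap; filterᵇ; reverse; dropWhileᵇ)
open import Data.Bool.ListAction using (any; all)
open import Data.List.Membership.Propositional using (_∈_; _∉_)
open import Data.List.Relation.Unary.All using (All)
open import Data.List.Relation.Unary.Unique.Propositional using (Unique)
open import Data.Product using (Σ; _×_; _,_; proj₁)
open import Data.Sum using (_⊎_)
open import Data.Rational using (ℚ; 0ℚ; 1ℚ; _+_; _*_; _-_; _<_; _⊔_)
open import Relation.Binary.PropositionalEquality using (_≡_; _≢_)
open import Relation.Nullary using (¬_)

data Lit : Set where
  pos : ℕ → Lit
  neg : ℕ → Lit

litVar : Lit → ℕ
litVar (pos x) = x
litVar (neg x) = x

Assignment : Set
Assignment = ℕ → Bool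

evalLit : Assignment → Lit → Bool
evalLit σ (pos x) = σ x
evalLit σ (neg x) = not (σ x)

-- a clause is a disjunction of literals (identified with its set of members)
Clause : Set
Clause = List Lit

CNF : Set
CNF = List Clause

varsClause : Clause → List ℕ
varsClause c = map litVar c

varsCNF : CNF → List ℕ
varsCNF φ = concatMap varsClause φ

evalClause : Assignment → Clause → Bool
evalClause σ c = any (evalLit σ) c

evalCNF : Assignment → CNF → Bool
evalCNF σ φ = all (evalClause σ) φ

NonTautological : Clause → Set
NonTautological c = ¬ (Σ ℕ λ x → (pos x ∈ c) × (neg x ∈ c))

data Form : Set where
  var  : ℕ → Form
  tt   : Form
  ff   : Form
  ¬f_  : Form → Form
  _∧f_ : Form → Form → Form
  _∨f_ : Form → Form → Form

⟦_⟧ : Form → Assignment → Bool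
⟦ var x ⟧ σ = σ x
⟦ tt ⟧ σ = true
⟦ ff ⟧ σ = false
⟦ ¬f F ⟧ σ = not (⟦ F ⟧ σ)
⟦ F ∧f G ⟧ σ = ⟦ F ⟧ σ ∧ ⟦ G ⟧ σ
⟦ F ∨f G ⟧ σ = ⟦ F ⟧ σ ∨ ⟦ G ⟧ σ

varsForm : Form → List ℕ
varsForm (var x) = x ∷ []
varsForm tt = []
varsForm ff = []
varsForm (¬f F) = varsForm F
varsForm (F ∧f G) = varsForm F ++ varsForm G
varsForm (F ∨f G) = varsForm F ++ varsForm G

memᵇ : ℕ → List ℕ → Bool
memᵇ x xs = any (x ≡ᵇ_) xs

-- σ with the variables in S set according to τ  (substitution φ[τ(x)/x]_{x∈S})
override : Assignment → List ℕ → Assignment → Assignment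
override σ S τ v = if memᵇ v S then τ v else σ v

update : Assignment → ℕ → Bool → Assignment
update σ x b v = if v ≡ᵇ x then b else σ v

-- semantics of  ∃ x₁ … ∃ xₖ : F  (F given by its truth function)
existsOver : List ℕ → (Assignment → Bool) → Assignment → Bool
existsOver [] f σ = f σ
existsOver (x ∷ xs) f σ = existsOver xs f (update σ x true) ∨ existsOver xs f (update σ x false)

data Quant : Set where
  exQ : Quant
  rQ  : ℚ → Quant

Prefix : Set
Prefix = List (ℕ × Quant)

prefixVars : Prefix → List ℕ
prefixVars Q = map proj₁ Q

-- Q(ψ): the shortest prefix Q₁x₁…Qᵢxᵢ of Q containing all variables in vs
shortestPrefix : Prefix → List ℕ → Prefix
shortestPrefix Q vs = reverse (dropWhileᵇ (λ xq → not (memᵇ (proj₁ xq) vs)) (reverse Q))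

record IsSSAT (Q : Prefix) (φ : CNF) : Set where
  field
    distinct : Unique (prefixVars Q)
    probs    : ∀ {x p} → (x , rQ p) ∈ Q → (0ℚ < p) × (p < 1ℚ)
    covered  : ∀ {x} → x ∈ varsCNF φ → x ∈ prefixVars Q

InVA InVB InVAB : CNF → CNF → ℕ → Set
InVA A B x = (x ∈ varsCNF A) × (x ∉ varsCNF B)
InVB A B x = (x ∉ varsCNF A) × (x ∈ varsCNF B)
InVAB A B x = (x ∈ varsCNF A) × (x ∈ varsCNF B)

listVA listVB : CNF → CNF → List ℕ
listVA A B = filterᵇ (λ x → not (memᵇ x (varsCNF B))) (varsCNF A)
listVB A B = filterᵇ (λ x → not (memᵇ x (varsCNF A))) (varsCNF B)

AExists : CNF → CNF → Assignment → Bool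
AExists A B = existsOver (listVA A B) (λ ρ → evalCNF ρ A)

BbarForall : CNF → CNF → Assignment → Bool
BbarForall A B σ = not (existsOver (listVB A B) (λ ρ → evalCNF ρ B) σ)

record GeneralizedCraigInterpolant (A B : CNF) (I : Form) : Set where
  field
    varsI : ∀ {x} → x ∈ varsForm I → InVAB A B x
    lower : ∀ σ → (AExists A B σ ∧ BbarForall A B σ) ≡ true → ⟦ I ⟧ σ ≡ true
    upper : ∀ σ → ⟦ I ⟧ σ ≡ true → (AExists A B σ ∨ BbarForall A B σ) ≡ true

R2Cond : Prefix → CNF → Clause → Set
R2Cond Q φ c =
  (τ : Assignment) → All (λ l → evalLit τ l ≡ false) c →
  (σ : Assignment) →
  evalCNF (override σ (prefixVars (shortestPrefix Q (varsClause c))) τ) φ ≡ true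

-- c (as a set) is  c₁ ∨ c₂  where d₁ = c₁ ∨ ¬x and d₂ = c₂ ∨ x
IsResolvent : ℕ → Clause → Clause → Clause → Set
IsResolvent x d₁ d₂ c =
  ∀ l → (l ∈ c → ((l ∈ d₁) × (l ≢ neg x)) ⊎ ((l ∈ d₂) × (l ≢ pos x)))
      × (((l ∈ d₁) × (l ≢ neg x)) ⊎ ((l ∈ d₂) × (l ≢ pos x)) → l ∈ c)

combineProb : Quant → ℚ → ℚ → ℚ
combineProb exQ p₁ p₂ = p₁ ⊔ p₂
combineProb (rQ px) p₁ p₂ = px * p₁ + (1ℚ - px) * p₂

data InterpStep (A B : CNF) (x : ℕ) (I₁ I₂ : Form) : Form → Set where
  stepA  : InVA A B x → InterpStep A B x I₁ I₂ (I₁ ∨f I₂)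
  stepB  : InVB A B x → InterpStep A B x I₁ I₂ (I₁ ∧f I₂)
  stepAB : InVAB A B x → InterpStep A B x I₁ I₂ (((¬f (var x)) ∨f I₁) ∧f (var x ∨f I₂))

data Derives (Q : Prefix) (A B : CNF) : Clause → ℚ → Form → Set where
  r1A : ∀ {c} → c ∈ A → Derives Q A B c 0ℚ ff
  r1B : ∀ {c} → c ∈ B → Derives Q A B c 0ℚ tt
  r2  : ∀ {c} (I : Form) →
        NonTautological c →
        All (λ x → x ∈ varsCNF (A ++ B)) (varsClause c) →
        R2Cond Q (A ++ B) c →
        (∀ {x} → x ∈ varsForm I → InVAB A B x) →
        Derives Q A B c 1ℚ I
  r3  : ∀ {d₁ d₂ c p₁ p₂ I₁ I₂ I} (x : ℕ) (q : Quant) →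
        Derives Q A B d₁ p₁ I₁ →
        Derives Q A B d₂ p₂ I₂ →
        neg x ∈ d₁ → pos x ∈ d₂ →
        (x , q) ∈ Q →
        IsResolvent x d₁ d₂ c →
        x ∉ prefixVars (shortestPrefix Q (varsClause c)) →
        NonTautological c →
        InterpStep A B x I₁ I₂ I →
        Derives Q A B c (combineProb q p₁ p₂) I

module Submission where

-- Soundness. By induction on derivations, every derived pair (c^p, I) satisfies the invariant
-- `Interpolates c I`: under an assignment falsifying c, I is true when A can be satisfied by
-- changing only its local variables outside 𝒬(c) while B cannot (using its local variables
-- outside 𝒬(c)), and false in the opposite situation. For c = ∅ the prefix 𝒬(c) is empty and this
-- is exactly the generalized interpolant condition. In a resolution step on x the witness of the
-- winning side falsifies the premise selected by its value of x, and 𝒬(c) ⊆ 𝒬(premise) since x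
-- occurs in the premise but not in 𝒬(c).
--
-- Completeness. Walk the binary decision tree of the prefix. At a leaf the full assignment τ
-- either falsifies an input clause (R.1) or satisfies A ∧ B, and then the clause falsified by τ on
-- all variables is derivable by (R.2). At an inner node on x the clauses of the two children are
-- resolved on x, unless one of them lacks its pivot literal and can be reused as it is. A clause
-- obtained at a node mentions only the variables above it, so the root yields the empty clause.

open import Defs
open import Data.Bool using (Bool; true; false; not; _∧_; _∨_; T)
open import Data.Bool.Properties
  using (∧-conicalˡ; ∧-conicalʳ; ∨-conicalˡ; ∨-conicalʳ; ∧-zeroʳ; ∨-zeroʳ; ∧-identityʳ)
open import Data.List
  using (List; []; _∷_; _++_; [_]; _∷ʳ_; map; reverse; filter; dropWhileᵇ; takeWhileᵇ)
open import Data.List.Properties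
  using (++-assoc; ++-identityʳ; map-++; reverse-++; reverse-involutive; ∷-injective;
         takeWhile++dropWhile)
open import Data.List.Membership.Propositional using (_∈_; _∉_)
open import Data.List.Membership.Propositional.Properties
  using (∈-map⁺; ∈-map⁻; ∈-++⁺ˡ; ∈-++⁺ʳ; ∈-++⁻; ∈-filter⁺; ∈-filter⁻;
         ∈-concatMap⁺; ∈-concatMap⁻)
open import Data.List.Relation.Binary.Subset.Propositional using (_⊆_)
open import Data.List.Relation.Binary.Subset.Propositional.Properties using (∷⁺ʳ; map⁺)
open import Data.List.Relation.Unary.All as All using (All)
open import Data.List.Relation.Unary.All.Properties using (all-takeWhile)
open import Data.List.Relation.Unary.AllPairs using (_∷_)
open import Data.List.Relation.Unary.Any as Any using (here; there)
open import Data.List.Relation.Unary.Any.Properties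
  using (any⁺; any⁻; reverse⁻) renaming (++⁻ to Any-++⁻)
open import Data.List.Relation.Unary.Unique.Propositional using (Unique)
open import Data.Nat using (ℕ; _≡ᵇ_; _≟_)
open import Data.Nat.Properties using (≡ᵇ⇒≡; ≡⇒≡ᵇ)
open import Data.List.Membership.DecPropositional _≟_ using (_∈?_)
open import Data.Product using (Σ; ∃; _×_; _,_; proj₁; proj₂; map₁; map₂)
open import Data.Rational using (ℚ)
open import Data.Sum as Sum using (_⊎_; inj₁; inj₂; [_,_]′)
open import Function using (_∘_; _⇔_; mk⇔; Equivalence; case_of_)
open import Relation.Binary.Definitions using (DecidableEquality)
open import Relation.Binary.PropositionalEquality
  using (_≡_; _≢_; refl; sym; trans; cong; cong₂; subst; module ≡-Reasoning)
open import Relation.Nullary using (¬_; yes; no; contradiction; ¬?)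
open import Relation.Nullary.Decidable using (map′; T?)
open import Relation.Nullary.Reflects using (Reflects; ofʸ; ofⁿ; fromEquivalence)

open Equivalence using (to; from)

≡ᵇ-reflects-≡ : ∀ m n → Reflects (m ≡ n) (m ≡ᵇ n)
≡ᵇ-reflects-≡ m n = fromEquivalence (≡ᵇ⇒≡ m n) (≡⇒≡ᵇ m n)

memᵇ-reflects-∈ : ∀ x xs → Reflects (x ∈ xs) (memᵇ x xs)
memᵇ-reflects-∈ x xs = fromEquivalence
  (Any.map (≡ᵇ⇒≡ x _) ∘ any⁻ (x ≡ᵇ_) xs)
  (any⁺ (x ≡ᵇ_) ∘ Any.map (≡⇒≡ᵇ x _))

T-not-memᵇ : ∀ x xs → T (not (memᵇ x xs)) ⇔ x ∉ xs
T-not-memᵇ x xs with memᵇ x xs | memᵇ-reflects-∈ x xs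
... | true  | ofʸ x∈xs = mk⇔ (λ ()) (λ x∉xs → x∉xs x∈xs)
... | false | ofⁿ x∉xs = mk⇔ (λ _ → x∉xs) _

override-∈ : ∀ σ {S} τ {v} → v ∈ S → override σ S τ v ≡ τ v
override-∈ σ {S} τ {v} v∈S with memᵇ v S | memᵇ-reflects-∈ v S
... | true  | _        = refl
... | false | ofⁿ v∉S = contradiction v∈S v∉S

override-∉ : ∀ σ {S} τ {v} → v ∉ S → override σ S τ v ≡ σ v
override-∉ σ {S} τ {v} v∉S with memᵇ v S | memᵇ-reflects-∈ v S
... | true  | ofʸ v∈S = contradiction v∈S v∉S
... | false | _        = refl

override-self : ∀ σ S v → override σ S σ v ≡ σ v
override-self σ S v with memᵇ v S
... | true  = refl
... | false = refl

update-≡ : ∀ σ x b → update σ x b x ≡ b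
update-≡ σ x b with x ≡ᵇ x | ≡ᵇ-reflects-≡ x x
... | true  | _        = refl
... | false | ofⁿ x≢x = contradiction refl x≢x

update-≢ : ∀ σ x b {y} → y ≢ x → update σ x b y ≡ σ y
update-≢ σ x b {y} y≢x with y ≡ᵇ x | ≡ᵇ-reflects-≡ y x
... | true  | ofʸ y≡x = contradiction y≡x y≢x
... | false | _        = refl

AgreeOn : (ℕ → Set) → Assignment → Assignment → Set
AgreeOn P σ τ = ∀ {y} → P y → σ y ≡ τ y

AgreeOff : (ℕ → Set) → Assignment → Assignment → Set
AgreeOff P = AgreeOn (λ y → ¬ P y)

agreeOff-update : ∀ {P τ} σ x b → P x → AgreeOff P σ τ → AgreeOff P (update σ x b) τ
agreeOff-update σ x b Px agree ¬Py = trans (update-≢ σ x b λ { refl → ¬Py Px }) (agree ¬Py)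

agreeOff-update⁺ : ∀ {σ′ σ x b xs} → σ′ x ≡ b →
                   AgreeOff (_∈ x ∷ xs) σ′ σ → AgreeOff (_∈ xs) σ′ (update σ x b)
agreeOff-update⁺ {σ = σ} {x} {b} σ′x agree {y} y∉xs with y ≟ x
... | yes refl = trans σ′x (sym (update-≡ σ x b))
... | no  y≢x  = trans (agree λ { (here y≡x) → y≢x y≡x ; (there y∈xs) → y∉xs y∈xs })
                       (sym (update-≢ σ x b y≢x))

agreeOff-update⁻ : ∀ {σ′ σ x b xs} →
                   AgreeOff (_∈ xs) σ′ (update σ x b) → AgreeOff (_∈ x ∷ xs) σ′ σ
agreeOff-update⁻ {σ = σ} {x} {b} agree y∉ =
  trans (agree (y∉ ∘ there)) (update-≢ σ x b (y∉ ∘ here))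

evalLit-cong : ∀ {σ τ} l → σ (litVar l) ≡ τ (litVar l) → evalLit σ l ≡ evalLit τ l
evalLit-cong (pos x) eq = eq
evalLit-cong (neg x) eq = cong not eq

evalClause-cong : ∀ {σ τ} c → AgreeOn (_∈ varsClause c) σ τ → evalClause σ c ≡ evalClause τ c
evalClause-cong []      agree = refl
evalClause-cong (l ∷ c) agree =
  cong₂ _∨_ (evalLit-cong l (agree (here refl))) (evalClause-cong c (agree ∘ there))

evalCNF-cong : ∀ {σ τ} φ → AgreeOn (_∈ varsCNF φ) σ τ → evalCNF σ φ ≡ evalCNF τ φ
evalCNF-cong []      agree = refl
evalCNF-cong (c ∷ φ) agree =
  cong₂ _∧_ (evalClause-cong c (agree ∘ ∈-++⁺ˡ))
            (evalCNF-cong φ (agree ∘ ∈-++⁺ʳ (varsClause c)))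

⟦⟧-cong : ∀ {σ τ} F → AgreeOn (_∈ varsForm F) σ τ → ⟦ F ⟧ σ ≡ ⟦ F ⟧ τ
⟦⟧-cong (var x)  agree = agree (here refl)
⟦⟧-cong tt       agree = refl
⟦⟧-cong ff       agree = refl
⟦⟧-cong (¬f F)   agree = cong not (⟦⟧-cong F agree)
⟦⟧-cong (F ∧f G) agree =
  cong₂ _∧_ (⟦⟧-cong F (agree ∘ ∈-++⁺ˡ)) (⟦⟧-cong G (agree ∘ ∈-++⁺ʳ (varsForm F)))
⟦⟧-cong (F ∨f G) agree =
  cong₂ _∨_ (⟦⟧-cong F (agree ∘ ∈-++⁺ˡ)) (⟦⟧-cong G (agree ∘ ∈-++⁺ʳ (varsForm F)))

varsClause⊆ : ∀ {c V} → (∀ {l} → l ∈ c → litVar l ∈ V) → varsClause c ⊆ V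
varsClause⊆ lits∈V y∈c with ∈-map⁻ litVar y∈c
... | l , l∈c , refl = lits∈V l∈c

varsClause⊆varsCNF : ∀ {c φ} → c ∈ φ → varsClause c ⊆ varsCNF φ
varsClause⊆varsCNF c∈φ y∈c = ∈-concatMap⁺ varsClause (Any.map (λ { refl → y∈c }) c∈φ)

varsCNF-++⁻ : ∀ A {B y} → y ∈ varsCNF (A ++ B) → y ∈ varsCNF A ⊎ y ∈ varsCNF B
varsCNF-++⁻ A =
  Sum.map (∈-concatMap⁺ varsClause) (∈-concatMap⁺ varsClause)
  ∘ Any-++⁻ A ∘ ∈-concatMap⁻ varsClause

evalCNF-update-∉ : ∀ {σ x b} φ → x ∉ varsCNF φ → evalCNF (update σ x b) φ ≡ evalCNF σ φ
evalCNF-update-∉ {σ} {x} {b} φ x∉φ =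
  evalCNF-cong φ λ y∈φ → update-≢ σ x b λ { refl → x∉φ y∈φ }

evalCNF-++⁻ : ∀ {σ} A {B} → evalCNF σ (A ++ B) ≡ true →
              evalCNF σ A ≡ true × evalCNF σ B ≡ true
evalCNF-++⁻ []      AB-true = refl , AB-true
evalCNF-++⁻ (c ∷ A) AB-true with evalCNF-++⁻ A (∧-conicalʳ _ _ AB-true)
... | A-true , B-true = cong₂ _∧_ (∧-conicalˡ _ _ AB-true) A-true , B-true

Falsifies : Assignment → Clause → Set
Falsifies σ c = ∀ {l} → l ∈ c → evalLit σ l ≡ false

falsifies-cong : ∀ {σ τ c} → AgreeOn (_∈ varsClause c) σ τ → Falsifies τ c → Falsifies σ c
falsifies-cong agree τ⊭c {l} l∈c = trans (evalLit-cong l (agree (∈-map⁺ litVar l∈c))) (τ⊭c l∈c)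

falsified⇒nonTautological : ∀ {σ c} → Falsifies σ c → NonTautological c
falsified⇒nonTautological σ⊭c (x , x∈c , ¬x∈c) with trans (sym (cong not (σ⊭c x∈c))) (σ⊭c ¬x∈c)
... | ()

evalClause-falsified : ∀ {σ} c → Falsifies σ c → evalClause σ c ≡ false
evalClause-falsified []      σ⊭c = refl
evalClause-falsified (l ∷ c) σ⊭c =
  cong₂ _∨_ (σ⊭c (here refl)) (evalClause-falsified c (σ⊭c ∘ there))

evalClause≡false⇒falsified : ∀ {σ} c → evalClause σ c ≡ false → Falsifies σ c
evalClause≡false⇒falsified (l ∷ c) c-false (here refl) = ∨-conicalˡ _ _ c-false
evalClause≡false⇒falsified (l ∷ c) c-false (there l∈c) =
  evalClause≡false⇒falsified c (∨-conicalʳ _ _ c-false) l∈c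

evalCNF-falsified : ∀ {σ c φ} → c ∈ φ → Falsifies σ c → evalCNF σ φ ≡ false
evalCNF-falsified {c = c} (here refl) σ⊭c = cong (_∧ _) (evalClause-falsified c σ⊭c)
evalCNF-falsified (there c∈φ) σ⊭c = trans (cong (_ ∧_) (evalCNF-falsified c∈φ σ⊭c)) (∧-zeroʳ _)

evalCNF≡false⇒falsified : ∀ {σ} φ → evalCNF σ φ ≡ false → ∃ λ c → c ∈ φ × Falsifies σ c
evalCNF≡false⇒falsified {σ} (c ∷ φ) φ-false with evalClause σ c in c-value
... | false = c , here refl , evalClause≡false⇒falsified c c-value
... | true with evalCNF≡false⇒falsified φ φ-false
...   | d , d∈φ , σ⊭d = d , there d∈φ , σ⊭d

-- Satisfiability by changing a set of variables

SatisfiableOn : CNF → (ℕ → Set) → Assignment → Set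
SatisfiableOn F V σ = Σ Assignment λ σ′ → AgreeOff V σ′ σ × evalCNF σ′ F ≡ true

satisfied⇒SatisfiableOn : ∀ F {V σ} → evalCNF σ F ≡ true → SatisfiableOn F V σ
satisfied⇒SatisfiableOn F {σ = σ} sat = σ , (λ _ → refl) , sat

SatisfiableOn-transfer : ∀ F {V W σ τ} →
                         (∀ {y} → y ∈ varsCNF F → ¬ W y → ¬ V y × σ y ≡ τ y) →
                         SatisfiableOn F V σ → SatisfiableOn F W τ
SatisfiableOn-transfer F {W = W} {τ = τ} fixed (σ′ , agree , sat) =
  override τ (varsCNF F) σ′ , agree′ , trans (evalCNF-cong F (override-∈ τ σ′)) sat
  where
  agree′ : AgreeOff W (override τ (varsCNF F) σ′) τ
  agree′ {y} ¬Wy with y ∈? varsCNF F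
  ... | no  y∉F = override-∉ τ σ′ y∉F
  ... | yes y∈F = let ¬Vy , σy≡τy = fixed y∈F ¬Wy in
                  trans (override-∈ τ σ′ y∈F) (trans (agree ¬Vy) σy≡τy)

module _ {F : CNF} where

  existsOver-sound : ∀ {σ} xs → existsOver xs (λ ρ → evalCNF ρ F) σ ≡ true →
                     SatisfiableOn F (_∈ xs) σ
  existsOver-sound [] = satisfied⇒SatisfiableOn F
  existsOver-sound {σ} (x ∷ xs) ∃-true
    with existsOver xs (λ ρ → evalCNF ρ F) (update σ x true) in ∃-true₁
  ... | true  = map₂ (map₁ agreeOff-update⁻) (existsOver-sound xs ∃-true₁)
  ... | false = map₂ (map₁ agreeOff-update⁻) (existsOver-sound xs ∃-true)

  existsOver-complete : ∀ {σ} xs → SatisfiableOn F (_∈ xs) σ →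
                        existsOver xs (λ ρ → evalCNF ρ F) σ ≡ true
  existsOver-complete [] (σ′ , agree , sat) = trans (evalCNF-cong F λ _ → sym (agree λ ())) sat
  existsOver-complete (x ∷ xs) (σ′ , agree , sat) with σ′ x in σ′x
  ... | true  rewrite existsOver-complete xs (σ′ , agreeOff-update⁺ σ′x agree , sat) = refl
  ... | false rewrite existsOver-complete xs (σ′ , agreeOff-update⁺ σ′x agree , sat) = ∨-zeroʳ _

  existsOver⇔SatisfiableOn : ∀ {V σ} xs → (∀ {y} → y ∈ xs ⇔ V y) →
                             existsOver xs (λ ρ → evalCNF ρ F) σ ≡ true ⇔ SatisfiableOn F V σ
  existsOver⇔SatisfiableOn xs xs⇔V = mk⇔
    (SatisfiableOn-transfer F (λ _ ¬V → ¬V ∘ to xs⇔V , refl) ∘ existsOver-sound xs)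
    (existsOver-complete xs ∘ SatisfiableOn-transfer F (λ _ ∉xs → ∉xs ∘ from xs⇔V , refl))

∈-listVA : ∀ A B {y} → y ∈ listVA A B ⇔ InVA A B y
∈-listVA A B = mk⇔
  (map₂ (to (T-not-memᵇ _ (varsCNF B))) ∘ ∈-filter⁻ _)
  (λ (y∈A , y∉B) → ∈-filter⁺ _ y∈A (from (T-not-memᵇ _ (varsCNF B)) y∉B))

∈-listVB : ∀ A B {y} → y ∈ listVB A B ⇔ InVB A B y
∈-listVB A B = mk⇔
  ((λ (y∈B , y∉A) → to (T-not-memᵇ _ (varsCNF A)) y∉A , y∈B) ∘ ∈-filter⁻ _)
  (λ (y∉A , y∈B) → ∈-filter⁺ _ y∈B (from (T-not-memᵇ _ (varsCNF A)) y∉A))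

module _ {X : Set} (p : X → Bool) where

  dropWhileᵇ-++ : ∀ {ys zs} → (∀ {y} → y ∈ ys → T (p y)) →
                  dropWhileᵇ p (ys ++ zs) ≡ dropWhileᵇ p zs
  dropWhileᵇ-++ {[]}     _    = refl
  dropWhileᵇ-++ {y ∷ ys} ys-p with p y | ys-p (here refl)
  ... | true | _ = dropWhileᵇ-++ (ys-p ∘ there)

  dropWhileEndᵇ : List X → List X
  dropWhileEndᵇ xs = reverse (dropWhileᵇ p (reverse xs))

  dropWhileEndᵇ-++ : ∀ xs {R} → (∀ {r} → r ∈ R → T (p r)) →
                     dropWhileEndᵇ (xs ++ R) ≡ dropWhileEndᵇ xs
  dropWhileEndᵇ-++ xs {R} R-p =
    trans (cong (reverse ∘ dropWhileᵇ p) (reverse-++ xs R))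
          (cong reverse (dropWhileᵇ-++ (R-p ∘ reverse⁻)))

  dropWhileEndᵇ-suffix : ∀ xs → ∃ λ R → dropWhileEndᵇ xs ++ R ≡ xs × (∀ {r} → r ∈ R → T (p r))
  dropWhileEndᵇ-suffix xs =
    reverse (takeWhileᵇ p rxs) , split , All.lookup (all-takeWhile (T? ∘ p) rxs) ∘ reverse⁻
    where
    open ≡-Reasoning
    rxs : List X
    rxs = reverse xs
    split : dropWhileEndᵇ xs ++ reverse (takeWhileᵇ p rxs) ≡ xs
    split = begin
      reverse (dropWhileᵇ p rxs) ++ reverse (takeWhileᵇ p rxs)
        ≡⟨ reverse-++ (takeWhileᵇ p rxs) _ ⟨
      reverse (takeWhileᵇ p rxs ++ dropWhileᵇ p rxs)
        ≡⟨ cong reverse (takeWhile++dropWhile _ rxs) ⟩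
      reverse rxs
        ≡⟨ reverse-involutive xs ⟩
      xs ∎

  dropWhileEndᵇ-⊆ : ∀ xs → dropWhileEndᵇ xs ⊆ xs
  dropWhileEndᵇ-⊆ xs with dropWhileEndᵇ-suffix xs
  ... | _ , split , _ = subst (_ ∈_) split ∘ ∈-++⁺ˡ

++-prefixes-comparable : ∀ {X : Set} (xs us : List X) {ys vs} →
                         xs ++ ys ≡ us ++ vs → xs ⊆ us ⊎ us ⊆ xs
++-prefixes-comparable []       _        _  = inj₁ λ ()
++-prefixes-comparable (_ ∷ _)  []       _  = inj₂ λ ()
++-prefixes-comparable (x ∷ xs) (u ∷ us) eq with ∷-injective eq
... | refl , eq′ = Sum.map (∷⁺ʳ x) (∷⁺ʳ x) (++-prefixes-comparable xs us eq′)

Unique-++⇒disjoint : ∀ xs {ys : List ℕ} {y} → Unique (xs ++ ys) → y ∈ xs → y ∉ ys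
Unique-++⇒disjoint (x ∷ xs) (x∉ ∷ _) (here refl)  y∈ys = All.lookup x∉ (∈-++⁺ʳ xs y∈ys) refl
Unique-++⇒disjoint (x ∷ xs) (_ ∷ u)  (there y∈xs) = Unique-++⇒disjoint xs u y∈xs

_≟ˡ_ : DecidableEquality Lit
pos x ≟ˡ pos y = map′ (cong pos) (λ { refl → refl }) (x ≟ y)
neg x ≟ˡ neg y = map′ (cong neg) (λ { refl → refl }) (x ≟ y)
pos _ ≟ˡ neg _ = no λ ()
neg _ ≟ˡ pos _ = no λ ()

falsifyingLit : Bool → ℕ → Lit
falsifyingLit true  y = neg y
falsifyingLit false y = pos y

falsifyingLit-false : ∀ σ b y → evalLit σ (falsifyingLit b y) ≡ false ⇔ σ y ≡ b
falsifyingLit-false σ true  y with σ y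
... | true  = mk⇔ (λ _ → refl) (λ _ → refl)
... | false = mk⇔ (λ ()) (λ ())
falsifyingLit-false σ false y = mk⇔ (λ e → e) (λ e → e)

falsifyingLit-unique : ∀ {σ x b l} → σ x ≡ b → evalLit σ l ≡ false → litVar l ≡ x →
                       l ≡ falsifyingLit b x
falsifyingLit-unique {b = true}  {pos x} σx σ⊭l refl with trans (sym σx) σ⊭l
... | ()
falsifyingLit-unique {b = false} {pos x} σx σ⊭l refl = refl
falsifyingLit-unique {b = true}  {neg x} σx σ⊭l refl = refl
falsifyingLit-unique {b = false} {neg x} σx σ⊭l refl with trans (sym (cong not σx)) σ⊭l
... | ()

falsifier : Assignment → List ℕ → Clause
falsifier τ = map λ y → falsifyingLit (τ y) y

varsClause-falsifier : ∀ τ ys → varsClause (falsifier τ ys) ≡ ys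
varsClause-falsifier τ []       = refl
varsClause-falsifier τ (y ∷ ys) = cong₂ _∷_ (litVar-falsifyingLit (τ y)) (varsClause-falsifier τ ys)
  where litVar-falsifyingLit : ∀ b → litVar (falsifyingLit b y) ≡ y
        litVar-falsifyingLit true  = refl
        litVar-falsifyingLit false = refl

falsifier-falsified : ∀ τ ys → Falsifies τ (falsifier τ ys)
falsifier-falsified τ ys l∈ with ∈-map⁻ _ l∈
... | y , _ , refl = from (falsifyingLit-false τ (τ y) y) refl

falsifier-forces : ∀ {τ′} τ ys → Falsifies τ′ (falsifier τ ys) → AgreeOn (_∈ ys) τ′ τ
falsifier-forces τ ys τ′⊭c {y} y∈ys = to (falsifyingLit-false _ (τ y) y) (τ′⊭c (∈-map⁺ _ y∈ys))

resolvent : ℕ → Clause → Clause → Clause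
resolvent x d₁ d₂ = filter (λ l → ¬? (l ≟ˡ neg x)) d₁ ++ filter (λ l → ¬? (l ≟ˡ pos x)) d₂

resolvent-isResolvent : ∀ x d₁ d₂ → IsResolvent x d₁ d₂ (resolvent x d₁ d₂)
resolvent-isResolvent x d₁ d₂ l = split , join
  where
  split : l ∈ resolvent x d₁ d₂ → (l ∈ d₁ × l ≢ neg x) ⊎ (l ∈ d₂ × l ≢ pos x)
  split = Sum.map (∈-filter⁻ _) (∈-filter⁻ _) ∘ ∈-++⁻ _
  join : (l ∈ d₁ × l ≢ neg x) ⊎ (l ∈ d₂ × l ≢ pos x) → l ∈ resolvent x d₁ d₂
  join (inj₁ (l∈d₁ , l≢¬x)) = ∈-++⁺ˡ (∈-filter⁺ _ l∈d₁ l≢¬x)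
  join (inj₂ (l∈d₂ , l≢x))  = ∈-++⁺ʳ _ (∈-filter⁺ _ l∈d₂ l≢x)

premise₁-falsified : ∀ {σ x d₁ d₂ c} → IsResolvent x d₁ d₂ c →
                     Falsifies σ c → σ x ≡ true → Falsifies σ d₁
premise₁-falsified {x = x} res σ⊭c σx {l} l∈d₁ with l ≟ˡ neg x
... | yes refl = cong not σx
... | no  l≢¬x = σ⊭c (proj₂ (res l) (inj₁ (l∈d₁ , l≢¬x)))

premise₂-falsified : ∀ {σ x d₁ d₂ c} → IsResolvent x d₁ d₂ c →
                     Falsifies σ c → σ x ≡ false → Falsifies σ d₂
premise₂-falsified {x = x} res σ⊭c σx {l} l∈d₂ with l ≟ˡ pos x
... | yes refl = σx
... | no  l≢x  = σ⊭c (proj₂ (res l) (inj₂ (l∈d₂ , l≢x)))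

-- (¬x ∨ I₁) ∧ (x ∨ I₂) is "if x then I₁ else I₂"
case-split-by : ∀ s {i₁ i₂ v} → (s ≡ true → i₁ ≡ v) → (s ≡ false → i₂ ≡ v) →
                (not s ∨ i₁) ∧ (s ∨ i₂) ≡ v
case-split-by true  if-true _        = trans (∧-identityʳ _) (if-true refl)
case-split-by false _       if-false = if-false refl

module Interpolation (Q : Prefix) (A B : CNF) (ssat : IsSSAT Q (A ++ B)) where

  open IsSSAT ssat

  scope : Clause → List ℕ
  scope c = prefixVars (shortestPrefix Q (varsClause c))

  -- shortestPrefix Q vs is dropWhileEndᵇ (λ xq → not (memᵇ (proj₁ xq) vs)) Q by definition
  scope-suffix : ∀ c → ∃ λ R → scope c ++ R ≡ prefixVars Q × (∀ {y} → y ∈ R → y ∉ varsClause c)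
  scope-suffix c with dropWhileEndᵇ-suffix (λ xq → not (memᵇ (proj₁ xq) (varsClause c))) Q
  ... | R , split , R-dropped =
    map proj₁ R , trans (sym (map-++ proj₁ _ R)) (cong (map proj₁) split) , R∌c
    where R∌c : ∀ {y} → y ∈ map proj₁ R → y ∉ varsClause c
          R∌c y∈R with ∈-map⁻ proj₁ y∈R
          ... | r , r∈R , refl = to (T-not-memᵇ _ _) (R-dropped r∈R)

  ∈-scope : ∀ {c y} → y ∈ prefixVars Q → y ∈ varsClause c → y ∈ scope c
  ∈-scope {c} y∈Q y∈c with scope-suffix c
  ... | R , split , R∌c with ∈-++⁻ (scope c) (subst (_ ∈_) (sym split) y∈Q)
  ...   | inj₁ y∈scope = y∈scope
  ...   | inj₂ y∈R     = contradiction y∈c (R∌c y∈R)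

  scope-mono : ∀ c d {x} → x ∈ prefixVars Q → x ∈ varsClause d → x ∉ scope c → scope c ⊆ scope d
  scope-mono c d x∈Q x∈d x∉c with scope-suffix c | scope-suffix d
  ... | _ , split-c , _ | _ , split-d , _
    with ++-prefixes-comparable (scope c) (scope d) (trans split-c (sym split-d))
  ...   | inj₁ c⊆d = c⊆d
  ...   | inj₂ d⊆c = contradiction (d⊆c (∈-scope x∈Q x∈d)) x∉c

  scope-[] : scope [] ≡ []
  scope-[] = cong (map proj₁) (dropWhileEndᵇ-++ (λ xq → not (memᵇ (proj₁ xq) [])) [] {Q} _)

  ∉-scope-[] : ∀ {y} → y ∉ scope []
  ∉-scope-[] y∈ with subst (_ ∈_) scope-[] y∈
  ... | ()

  prefix-disjoint : ∀ {Pre Rest y} → Q ≡ Pre ++ Rest → y ∈ prefixVars Pre → y ∉ prefixVars Rest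
  prefix-disjoint {Pre} {Rest} split = Unique-++⇒disjoint (prefixVars Pre)
    (subst Unique (trans (cong prefixVars split) (map-++ proj₁ Pre Rest)) distinct)

  scope-⊆ : ∀ {Pre Rest c} → Q ≡ Pre ++ Rest → (∀ {l} → l ∈ c → litVar l ∈ prefixVars Pre) →
            scope c ⊆ prefixVars Pre
  scope-⊆ {Pre} {Rest} {c} split c⊆Pre =
    map⁺ proj₁ (dropWhileEndᵇ-⊆ p Pre) ∘ subst (_ ∈_) scope≡
    where
    p : ℕ × Quant → Bool
    p xq = not (memᵇ (proj₁ xq) (varsClause c))
    Rest-dropped : ∀ {r} → r ∈ Rest → T (p r)
    Rest-dropped r∈ = from (T-not-memᵇ _ _) λ r∈c →
      prefix-disjoint split (varsClause⊆ c⊆Pre r∈c) (∈-map⁺ proj₁ r∈)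
    scope≡ : scope c ≡ map proj₁ (dropWhileEndᵇ p Pre)
    scope≡ = cong (map proj₁)
      (trans (cong (dropWhileEndᵇ p) split) (dropWhileEndᵇ-++ p Pre Rest-dropped))

  derived-vars : ∀ {c p I} → Derives Q A B c p I → varsClause c ⊆ varsCNF (A ++ B)
  derived-vars (r1A c∈A)        = varsClause⊆varsCNF (∈-++⁺ˡ c∈A)
  derived-vars (r1B c∈B)        = varsClause⊆varsCNF (∈-++⁺ʳ A c∈B)
  derived-vars (r2 _ _ c⊆φ _ _) = All.lookup c⊆φ
  derived-vars (r3 _ _ D₁ D₂ _ _ _ res _ _ _) = varsClause⊆ λ {l} →
    [ derived-vars D₁ ∘ ∈-map⁺ litVar ∘ proj₁ , derived-vars D₂ ∘ ∈-map⁺ litVar ∘ proj₁ ]′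
    ∘ proj₁ (res l)

  derived-vars⊆scope : ∀ {c p I} → Derives Q A B c p I → varsClause c ⊆ scope c
  derived-vars⊆scope D y∈c = ∈-scope (covered (derived-vars D y∈c)) y∈c

  OverShared : Form → Set
  OverShared I = ∀ {y} → y ∈ varsForm I → InVAB A B y

  interpStep-shared : ∀ {x I₁ I₂ I} → InterpStep A B x I₁ I₂ I →
                      OverShared I₁ → OverShared I₂ → OverShared I
  interpStep-shared {I₁ = I₁} (stepA _) shared₁ shared₂ =
    [ shared₁ , shared₂ ]′ ∘ ∈-++⁻ (varsForm I₁)
  interpStep-shared {I₁ = I₁} (stepB _) shared₁ shared₂ =
    [ shared₁ , shared₂ ]′ ∘ ∈-++⁻ (varsForm I₁)
  interpStep-shared {x} {I₁} {I₂} (stepAB x-shared) shared₁ shared₂ =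
    [ with-x I₁ shared₁ , with-x I₂ shared₂ ]′ ∘ ∈-++⁻ (x ∷ varsForm I₁)
    where with-x : ∀ J → OverShared J → ∀ {y} → y ∈ x ∷ varsForm J → InVAB A B y
          with-x _ _      (here refl) = x-shared
          with-x _ shared (there y∈J) = shared y∈J

  derived-interpolant-shared : ∀ {c p I} → Derives Q A B c p I → OverShared I
  derived-interpolant-shared (r1A _) ()
  derived-interpolant-shared (r1B _) ()
  derived-interpolant-shared (r2 _ _ _ _ shared) = shared
  derived-interpolant-shared (r3 _ _ D₁ D₂ _ _ _ _ _ _ step) =
    interpStep-shared step (derived-interpolant-shared D₁) (derived-interpolant-shared D₂)

  interpStep : ∀ x I₁ I₂ → x ∈ varsCNF (A ++ B) → Σ Form (InterpStep A B x I₁ I₂)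
  interpStep x I₁ I₂ x∈φ with x ∈? varsCNF A | x ∈? varsCNF B
  ... | yes x∈A | yes x∈B = _ , stepAB (x∈A , x∈B)
  ... | yes x∈A | no  x∉B = _ , stepA (x∈A , x∉B)
  ... | no  x∉A | yes x∈B = _ , stepB (x∉A , x∈B)
  ... | no  x∉A | no  x∉B = contradiction (varsCNF-++⁻ A x∈φ) [ x∉A , x∉B ]′

  -- Soundness

  FreeA FreeB Free : List ℕ → ℕ → Set
  FreeA K y = InVA A B y × y ∉ K
  FreeB K y = InVB A B y × y ∉ K
  Free K y = FreeA K y ⊎ FreeB K y

  SatA SatB : List ℕ → Assignment → Set
  SatA K = SatisfiableOn A (FreeA K)
  SatB K = SatisfiableOn B (FreeB K)

  Separates : List ℕ → Assignment → Form → Set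
  Separates K σ I = (SatA K σ → ¬ SatB K σ → ⟦ I ⟧ σ ≡ true) × (¬ SatA K σ → SatB K σ → ⟦ I ⟧ σ ≡ false)

  Interpolates : Clause → Form → Set
  Interpolates c I = ∀ σ → Falsifies σ c → Separates (scope c) σ I

  shared-not-free : ∀ {K y} → InVAB A B y → ¬ Free K y
  shared-not-free (_ , y∈B) (inj₁ ((_ , y∉B) , _)) = y∉B y∈B
  shared-not-free (y∈A , _) (inj₂ ((y∉A , _) , _)) = y∉A y∈A

  A-not-freeB : ∀ {K y} → y ∈ varsCNF A → ¬ FreeB K y
  A-not-freeB y∈A ((y∉A , _) , _) = y∉A y∈A

  B-not-freeA : ∀ {K y} → y ∈ varsCNF B → ¬ FreeA K y
  B-not-freeA y∈B ((_ , y∉B) , _) = y∉B y∈B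

  ∈⇒¬Free : ∀ {K y} → y ∈ K → ¬ Free K y
  ∈⇒¬Free y∈K free = [ proj₂ , proj₂ ]′ free y∈K

  unsatisfiable-at-input : ∀ {F V σ c} → c ∈ F → Falsifies σ c →
                           (∀ {y} → y ∈ varsClause c → ¬ V y) → ¬ SatisfiableOn F V σ
  unsatisfiable-at-input c∈F σ⊭c c-fixed (σ′ , agree , sat)
    with trans (sym sat) (evalCNF-falsified c∈F (falsifies-cong (agree ∘ c-fixed) σ⊭c))
  ... | ()

  child-true : ∀ d J {K σ σ*} → Interpolates d J → OverShared J → K ⊆ scope d → Falsifies σ* d →
               AgreeOff (Free K) σ* σ → evalCNF σ* A ≡ true → ¬ SatB K σ → ⟦ J ⟧ σ ≡ true
  child-true d J {K} {σ} {σ*} IH shared K⊆d σ*⊭d agree A-true ¬satB = begin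
    ⟦ J ⟧ σ  ≡⟨ ⟦⟧-cong J (λ y∈J → sym (agree (shared-not-free (shared y∈J)))) ⟩
    ⟦ J ⟧ σ* ≡⟨ proj₁ (IH σ* σ*⊭d) (satisfied⇒SatisfiableOn A A-true) (¬satB ∘ shrink) ⟩
    true     ∎
    where
    open ≡-Reasoning
    shrink : SatB (scope d) σ* → SatB K σ
    shrink = SatisfiableOn-transfer B λ y∈B ¬free →
      (λ (y-local , y∉d) → ¬free (y-local , y∉d ∘ K⊆d)) , agree [ B-not-freeA y∈B , ¬free ]′

  child-false : ∀ d J {K σ σ*} → Interpolates d J → OverShared J → K ⊆ scope d → Falsifies σ* d →
                AgreeOff (Free K) σ* σ → evalCNF σ* B ≡ true → ¬ SatA K σ → ⟦ J ⟧ σ ≡ false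
  child-false d J {K} {σ} {σ*} IH shared K⊆d σ*⊭d agree B-true ¬satA = begin
    ⟦ J ⟧ σ  ≡⟨ ⟦⟧-cong J (λ y∈J → sym (agree (shared-not-free (shared y∈J)))) ⟩
    ⟦ J ⟧ σ* ≡⟨ proj₂ (IH σ* σ*⊭d) (¬satA ∘ shrink) (satisfied⇒SatisfiableOn B B-true) ⟩
    false    ∎
    where
    open ≡-Reasoning
    shrink : SatA (scope d) σ* → SatA K σ
    shrink = SatisfiableOn-transfer A λ y∈A ¬free →
      (λ (y-local , y∉d) → ¬free (y-local , y∉d ∘ K⊆d)) , agree [ ¬free , A-not-freeB y∈A ]′

  record Branches (K : List ℕ) (σ : Assignment) (x : ℕ) (I₁ I₂ : Form) : Set where
    field
      A-side₁ : ∀ {σ*} → AgreeOff (Free K) σ* σ → σ* x ≡ true →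
                evalCNF σ* A ≡ true → ¬ SatB K σ → ⟦ I₁ ⟧ σ ≡ true
      A-side₂ : ∀ {σ*} → AgreeOff (Free K) σ* σ → σ* x ≡ false →
                evalCNF σ* A ≡ true → ¬ SatB K σ → ⟦ I₂ ⟧ σ ≡ true
      B-side₁ : ∀ {σ*} → AgreeOff (Free K) σ* σ → σ* x ≡ true →
                evalCNF σ* B ≡ true → ¬ SatA K σ → ⟦ I₁ ⟧ σ ≡ false
      B-side₂ : ∀ {σ*} → AgreeOff (Free K) σ* σ → σ* x ≡ false →
                evalCNF σ* B ≡ true → ¬ SatA K σ → ⟦ I₂ ⟧ σ ≡ false

  module _ {K σ x I₁ I₂} (branches : Branches K σ x I₁ I₂) (x∉K : x ∉ K) where

    open Branches branches

    -- With x local to A, the value of x in A's witness selects the premise, while B's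
    -- witness can be extended by either value of x.
    stepA-separates : InVA A B x → Separates K σ (I₁ ∨f I₂)
    stepA-separates x-local = A-wins , B-wins
      where
      A-wins : SatA K σ → ¬ SatB K σ → ⟦ I₁ ⟧ σ ∨ ⟦ I₂ ⟧ σ ≡ true
      A-wins (σA , agree , A-true) ¬satB with σA x in σAx
      ... | true  = cong (_∨ _) (A-side₁ (agree ∘ (_∘ inj₁)) σAx A-true ¬satB)
      ... | false = trans (cong (_ ∨_) (A-side₂ (agree ∘ (_∘ inj₁)) σAx A-true ¬satB)) (∨-zeroʳ _)
      B-wins : ¬ SatA K σ → SatB K σ → ⟦ I₁ ⟧ σ ∨ ⟦ I₂ ⟧ σ ≡ false
      B-wins ¬satA (σB , agree , B-true) =
        cong₂ _∨_ (B-side₁ (agree′ true) (update-≡ σB x true) (B-true′ true) ¬satA)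
                  (B-side₂ (agree′ false) (update-≡ σB x false) (B-true′ false) ¬satA)
        where
        agree′ : ∀ b → AgreeOff (Free K) (update σB x b) σ
        agree′ b = agreeOff-update σB x b (inj₁ (x-local , x∉K)) (agree ∘ (_∘ inj₂))
        B-true′ : ∀ b → evalCNF (update σB x b) B ≡ true
        B-true′ b = trans (evalCNF-update-∉ B (proj₂ x-local)) B-true

    stepB-separates : InVB A B x → Separates K σ (I₁ ∧f I₂)
    stepB-separates x-local = A-wins , B-wins
      where
      A-wins : SatA K σ → ¬ SatB K σ → ⟦ I₁ ⟧ σ ∧ ⟦ I₂ ⟧ σ ≡ true
      A-wins (σA , agree , A-true) ¬satB =
        cong₂ _∧_ (A-side₁ (agree′ true) (update-≡ σA x true) (A-true′ true) ¬satB)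
                  (A-side₂ (agree′ false) (update-≡ σA x false) (A-true′ false) ¬satB)
        where
        agree′ : ∀ b → AgreeOff (Free K) (update σA x b) σ
        agree′ b = agreeOff-update σA x b (inj₂ (x-local , x∉K)) (agree ∘ (_∘ inj₁))
        A-true′ : ∀ b → evalCNF (update σA x b) A ≡ true
        A-true′ b = trans (evalCNF-update-∉ A (proj₁ x-local)) A-true
      B-wins : ¬ SatA K σ → SatB K σ → ⟦ I₁ ⟧ σ ∧ ⟦ I₂ ⟧ σ ≡ false
      B-wins ¬satA (σB , agree , B-true) with σB x in σBx
      ... | true  = cong (_∧ _) (B-side₁ (agree ∘ (_∘ inj₂)) σBx B-true ¬satA)
      ... | false = trans (cong (_ ∧_) (B-side₂ (agree ∘ (_∘ inj₂)) σBx B-true ¬satA)) (∧-zeroʳ _)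

    stepAB-separates : InVAB A B x → Separates K σ (((¬f (var x)) ∨f I₁) ∧f (var x ∨f I₂))
    stepAB-separates x-shared = A-wins , B-wins
      where
      A-wins : SatA K σ → ¬ SatB K σ → (not (σ x) ∨ ⟦ I₁ ⟧ σ) ∧ (σ x ∨ ⟦ I₂ ⟧ σ) ≡ true
      A-wins (σA , agree , A-true) ¬satB = case-split-by (σ x)
        (λ σx → A-side₁ agree′ (trans σAx σx) A-true ¬satB)
        (λ σx → A-side₂ agree′ (trans σAx σx) A-true ¬satB)
        where
        agree′ : AgreeOff (Free K) σA σ
        agree′ = agree ∘ (_∘ inj₁)
        σAx : σA x ≡ σ x
        σAx = agree′ (shared-not-free x-shared)
      B-wins : ¬ SatA K σ → SatB K σ → (not (σ x) ∨ ⟦ I₁ ⟧ σ) ∧ (σ x ∨ ⟦ I₂ ⟧ σ) ≡ false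
      B-wins ¬satA (σB , agree , B-true) = case-split-by (σ x)
        (λ σx → B-side₁ agree′ (trans σBx σx) B-true ¬satA)
        (λ σx → B-side₂ agree′ (trans σBx σx) B-true ¬satA)
        where
        agree′ : AgreeOff (Free K) σB σ
        agree′ = agree ∘ (_∘ inj₂)
        σBx : σB x ≡ σ x
        σBx = agree′ (shared-not-free x-shared)

    step-separates : ∀ {I} → InterpStep A B x I₁ I₂ I → Separates K σ I
    step-separates (stepA x-local)   = stepA-separates x-local
    step-separates (stepB x-local)   = stepB-separates x-local
    step-separates (stepAB x-shared) = stepAB-separates x-shared

  interpolates : ∀ {c p I} → Derives Q A B c p I → Interpolates c I
  interpolates D@(r1A {c} c∈A) σ σ⊭c =
    (λ satA _ → contradiction satA (unsatisfiable-at-input c∈A σ⊭c c-fixed)) , (λ _ _ → refl)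
    where c-fixed : ∀ {y} → y ∈ varsClause c → ¬ FreeA (scope c) y
          c-fixed y∈c = ∈⇒¬Free (derived-vars⊆scope D y∈c) ∘ inj₁
  interpolates D@(r1B {c} c∈B) σ σ⊭c =
    (λ _ _ → refl) , (λ _ satB → contradiction satB (unsatisfiable-at-input c∈B σ⊭c c-fixed))
    where c-fixed : ∀ {y} → y ∈ varsClause c → ¬ FreeB (scope c) y
          c-fixed y∈c = ∈⇒¬Free (derived-vars⊆scope D y∈c) ∘ inj₂
  interpolates (r2 {c} _ _ _ cond _) σ σ⊭c =
    (λ _ ¬satB → contradiction (satisfied⇒SatisfiableOn B B-true) ¬satB) ,
    (λ ¬satA _ → contradiction (satisfied⇒SatisfiableOn A A-true) ¬satA)
    where
    σ⊨φ : evalCNF σ (A ++ B) ≡ true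
    σ⊨φ = trans (evalCNF-cong (A ++ B) λ {y} _ → sym (override-self σ (scope c) y))
                (cond σ (All.tabulate σ⊭c) σ)
    A-true : evalCNF σ A ≡ true
    A-true = proj₁ (evalCNF-++⁻ A σ⊨φ)
    B-true : evalCNF σ B ≡ true
    B-true = proj₂ (evalCNF-++⁻ A σ⊨φ)
  interpolates D@(r3 {d₁} {d₂} {c} {I₁ = I₁} {I₂} x _ D₁ D₂ ¬x∈d₁ x∈d₂ xq∈Q res x∉K _ step) σ σ⊭c =
    step-separates branches x∉K step
    where
    falsifies-c : ∀ {σ*} → AgreeOff (Free (scope c)) σ* σ → Falsifies σ* c
    falsifies-c agree = falsifies-cong (agree ∘ ∈⇒¬Free ∘ derived-vars⊆scope D) σ⊭c
    premise₁ : ∀ {σ*} → AgreeOff (Free (scope c)) σ* σ → σ* x ≡ true → Falsifies σ* d₁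
    premise₁ = premise₁-falsified res ∘ falsifies-c
    premise₂ : ∀ {σ*} → AgreeOff (Free (scope c)) σ* σ → σ* x ≡ false → Falsifies σ* d₂
    premise₂ = premise₂-falsified res ∘ falsifies-c
    c⊆d₁ : scope c ⊆ scope d₁
    c⊆d₁ = scope-mono c d₁ (∈-map⁺ proj₁ xq∈Q) (∈-map⁺ litVar ¬x∈d₁) x∉K
    c⊆d₂ : scope c ⊆ scope d₂
    c⊆d₂ = scope-mono c d₂ (∈-map⁺ proj₁ xq∈Q) (∈-map⁺ litVar x∈d₂) x∉K
    IH₁ : Interpolates d₁ I₁
    IH₁ = interpolates D₁
    IH₂ : Interpolates d₂ I₂
    IH₂ = interpolates D₂
    shared₁ : OverShared I₁
    shared₁ = derived-interpolant-shared D₁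
    shared₂ : OverShared I₂
    shared₂ = derived-interpolant-shared D₂
    branches : Branches (scope c) σ x I₁ I₂
    branches = record
      { A-side₁ = λ agree σ*x → child-true  d₁ I₁ IH₁ shared₁ c⊆d₁ (premise₁ agree σ*x) agree
      ; A-side₂ = λ agree σ*x → child-true  d₂ I₂ IH₂ shared₂ c⊆d₂ (premise₂ agree σ*x) agree
      ; B-side₁ = λ agree σ*x → child-false d₁ I₁ IH₁ shared₁ c⊆d₁ (premise₁ agree σ*x) agree
      ; B-side₂ = λ agree σ*x → child-false d₂ I₂ IH₂ shared₂ c⊆d₂ (premise₂ agree σ*x) agree
      }

  interpolant : ∀ {p I} → Derives Q A B [] p I → GeneralizedCraigInterpolant A B I
  interpolant {I = I} D = record
    { varsI = derived-interpolant-shared D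
    ; lower = lower
    ; upper = upper
    }
    where
    A⇔ : ∀ {σ} → AExists A B σ ≡ true ⇔ SatA (scope []) σ
    A⇔ = existsOver⇔SatisfiableOn {A} (listVA A B)
      (mk⇔ (λ y∈ → to (∈-listVA A B) y∈ , ∉-scope-[]) (from (∈-listVA A B) ∘ proj₁))
    B⇔ : ∀ {σ} → existsOver (listVB A B) (λ ρ → evalCNF ρ B) σ ≡ true ⇔ SatB (scope []) σ
    B⇔ = existsOver⇔SatisfiableOn {B} (listVB A B)
      (mk⇔ (λ y∈ → to (∈-listVB A B) y∈ , ∉-scope-[]) (from (∈-listVB A B) ∘ proj₁))

    -- in the omitted cases `both` reduces to false ≡ true
    lower : ∀ σ → (AExists A B σ ∧ BbarForall A B σ) ≡ true → ⟦ I ⟧ σ ≡ true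
    lower σ both with AExists A B σ in A∃ | existsOver (listVB A B) (λ ρ → evalCNF ρ B) σ in B∃
    ... | true | false = proj₁ (interpolates D σ λ ()) (to A⇔ A∃)
                               λ satB → case trans (sym B∃) (from B⇔ satB) of λ ()

    upper : ∀ σ → ⟦ I ⟧ σ ≡ true → (AExists A B σ ∨ BbarForall A B σ) ≡ true
    upper σ Iσ with AExists A B σ in A∃ | existsOver (listVB A B) (λ ρ → evalCNF ρ B) σ in B∃
    ... | true  | _     = refl
    ... | false | false = refl
    ... | false | true  =
      case trans (sym Iσ) (proj₂ (interpolates D σ λ ()) ¬satA (to B⇔ B∃)) of λ ()
      where ¬satA : ¬ SatA (scope []) σ
            ¬satA satA = case trans (sym A∃) (from A⇔ satA) of λ ()

  -- Completeness

  record Conflict (Pre : Prefix) (τ : Assignment) : Set where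
    constructor mkConflict
    field
      clause     : Clause
      prob       : ℚ
      interp     : Form
      derivation : Derives Q A B clause prob interp
      falsified  : Falsifies τ clause
      within     : ∀ {l} → l ∈ clause → litVar l ∈ prefixVars Pre

  open Conflict

  satisfied-conflict : ∀ τ → evalCNF τ (A ++ B) ≡ true → Conflict Q τ
  satisfied-conflict τ φτ = mkConflict c _ _
    (r2 tt (falsified⇒nonTautological τ⊭c) (All.tabulate c⊆φ) cond λ ())
    τ⊭c (covered ∘ c⊆φ ∘ ∈-map⁺ litVar)
    where
    c : Clause
    c = falsifier τ (varsCNF (A ++ B))
    τ⊭c : Falsifies τ c
    τ⊭c = falsifier-falsified τ (varsCNF (A ++ B))
    vars-c : varsClause c ≡ varsCNF (A ++ B)
    vars-c = varsClause-falsifier τ (varsCNF (A ++ B))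
    c⊆φ : varsClause c ⊆ varsCNF (A ++ B)
    c⊆φ = subst (_ ∈_) vars-c
    cond : R2Cond Q (A ++ B) c
    cond τ′ τ′⊭c σ = trans (evalCNF-cong (A ++ B) forced) φτ
      where forced : AgreeOn (_∈ varsCNF (A ++ B)) (override σ (scope c) τ′) τ
            forced y∈φ =
              trans (override-∈ σ τ′ (∈-scope (covered y∈φ) (subst (_ ∈_) (sym vars-c) y∈φ)))
                    (falsifier-forces τ (varsCNF (A ++ B)) (All.lookup τ′⊭c) y∈φ)

  input-within : ∀ {d} → d ∈ A ++ B → ∀ {l} → l ∈ d → litVar l ∈ prefixVars Q
  input-within d∈φ = covered ∘ varsClause⊆varsCNF d∈φ ∘ ∈-map⁺ litVar

  leaf-conflict : ∀ τ → Conflict Q τ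
  leaf-conflict τ with evalCNF τ (A ++ B) in φτ
  ... | true = satisfied-conflict τ φτ
  ... | false with evalCNF≡false⇒falsified (A ++ B) φτ
  ...   | d , d∈φ , τ⊭d with ∈-++⁻ A d∈φ
  ...     | inj₁ d∈A = mkConflict d _ _ (r1A d∈A) τ⊭d (input-within d∈φ)
  ...     | inj₂ d∈B = mkConflict d _ _ (r1B d∈B) τ⊭d (input-within d∈φ)

  module _ {Pre Rest x q} (split : Q ≡ Pre ++ (x , q) ∷ Rest) (τ : Assignment) where

    Child : Bool → Set
    Child b = Conflict (Pre ∷ʳ (x , q)) (update τ x b)

    lift : ∀ b (R : Child b) {l} → l ∈ clause R → l ≢ falsifyingLit b x →
           litVar l ∈ prefixVars Pre × evalLit τ l ≡ false
    lift b R {l} l∈R l≢pivot =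
      l∈Pre , trans (evalLit-cong l (sym (update-≢ τ x b l≢x))) (falsified R l∈R)
      where
      l≢x : litVar l ≢ x
      l≢x = l≢pivot ∘ falsifyingLit-unique (update-≡ τ x b) (falsified R l∈R)
      l∈Pre : litVar l ∈ prefixVars Pre
      l∈Pre with ∈-++⁻ (prefixVars Pre) (subst (_ ∈_) (map-++ proj₁ Pre _) (within R l∈R))
      ... | inj₁ l∈Pre     = l∈Pre
      ... | inj₂ (here eq) = contradiction eq l≢x

    keep : ∀ b (R : Child b) → falsifyingLit b x ∉ clause R → Conflict Pre τ
    keep b R pivot∉R = mkConflict _ _ _ (derivation R) (proj₂ ∘ lifted) (proj₁ ∘ lifted)
      where lifted : ∀ {l} → l ∈ clause R → litVar l ∈ prefixVars Pre × evalLit τ l ≡ false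
            lifted l∈R = lift b R l∈R λ { refl → pivot∉R l∈R }

    resolve : (R₁ : Child true) (R₀ : Child false) →
              neg x ∈ clause R₁ → pos x ∈ clause R₀ → Conflict Pre τ
    resolve R₁ R₀ ¬x∈R₁ x∈R₀ = mkConflict c _ _
      (r3 x q (derivation R₁) (derivation R₀) ¬x∈R₁ x∈R₀ xq∈Q res x∉scope
          (falsified⇒nonTautological (proj₂ ∘ lifted)) (proj₂ step))
      (proj₂ ∘ lifted) (proj₁ ∘ lifted)
      where
      c : Clause
      c = resolvent x (clause R₁) (clause R₀)
      res : IsResolvent x (clause R₁) (clause R₀) c
      res = resolvent-isResolvent x (clause R₁) (clause R₀)
      lifted : ∀ {l} → l ∈ c → litVar l ∈ prefixVars Pre × evalLit τ l ≡ false
      lifted {l} = [ (λ (l∈R₁ , l≢¬x) → lift true R₁ l∈R₁ l≢¬x)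
                   , (λ (l∈R₀ , l≢x) → lift false R₀ l∈R₀ l≢x) ]′ ∘ proj₁ (res l)
      xq∈Q : (x , q) ∈ Q
      xq∈Q = subst ((x , q) ∈_) (sym split) (∈-++⁺ʳ Pre (here refl))
      x∉scope : x ∉ scope c
      x∉scope x∈ = prefix-disjoint split (scope-⊆ split (proj₁ ∘ lifted) x∈) (here refl)
      step : Σ Form (InterpStep A B x (interp R₁) (interp R₀))
      step = interpStep x (interp R₁) (interp R₀)
                        (derived-vars (derivation R₁) (∈-map⁺ litVar ¬x∈R₁))

    branch : Child true → Child false → Conflict Pre τ
    branch R₁ R₀ with Any.any? (neg x ≟ˡ_) (clause R₁) | Any.any? (pos x ≟ˡ_) (clause R₀)
    ... | no  ¬x∉R₁ | _        = keep true R₁ ¬x∉R₁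
    ... | yes _     | no  x∉R₀ = keep false R₀ x∉R₀
    ... | yes ¬x∈R₁ | yes x∈R₀ = resolve R₁ R₀ ¬x∈R₁ x∈R₀

  conflict : ∀ Pre Rest → Q ≡ Pre ++ Rest → ∀ τ → Conflict Pre τ
  conflict Pre [] split τ =
    subst (λ P → Conflict P τ) (trans split (++-identityʳ Pre)) (leaf-conflict τ)
  conflict Pre ((x , q) ∷ Rest) split τ = branch split τ (child true) (child false)
    where child : ∀ b → Conflict (Pre ∷ʳ (x , q)) (update τ x b)
          child = conflict (Pre ∷ʳ (x , q)) Rest (trans split (sym (++-assoc Pre [ (x , q) ] Rest)))
                ∘ update τ x

open Interpolation

corollary3p5 : (Q : Prefix) (A B : CNF) →
    IsSSAT Q (A ++ B) →
    All NonTautological (A ++ B) →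
    Σ ℚ (λ p → Σ Form (λ I → Derives Q A B [] p I × GeneralizedCraigInterpolant A B I))
-- The rules as formalised never ask input clauses to be non-tautological.
corollary3p5 Q A B ssat _ with conflict Q A B ssat [] Q refl (λ _ → false)
... | mkConflict []      p I D _ _      = p , I , D , interpolant Q A B ssat D
... | mkConflict (l ∷ _) _ _ _ _ within = contradiction (within (here refl)) λ ()
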